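{- Let $\theta>0$ and $n\ge2$. Under the Ewens-like distribution for records with parameter $\theta$ on $\mathfrak{S}_n$, for every $i\in\{2,\dots,n\}$, $$\mathbb{P}_n\big(\sigma(i-1)>\sigma(i)\big)=\frac{(i-1)(2\theta+i-2)}{2(\theta+i-1)(\theta+i-2)}.$$
   Context: $\mathfrak{S}_n$ is the set of permutations of $[n]=\{1,\dots,n\}$. A permutation $\sigma$ has a record at position $i$ if $\sigma(i)>\sigma(j)$ for all $j<i$; $\mathrm{rec}(\sigma)$ is the number of records. The Ewens-like distribution for records with parameter $\theta>0$ gives each $\sigma\in\mathfrak{S}_n$ probability proportional to $\theta^{\mathrm{rec}(\sigma)}$; $\mathbb{P}_n$ denotes probability under it.
   Formalization: The parameter θ ranges over the positive rationals rather than any positive real number. -}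

module Defs where

open import Data.Nat as ℕ using (ℕ; zero; suc)
open import Data.Fin as Fin using (Fin; toℕ)
open import Data.Fin.Properties using (all?; _≟_)
open import Data.Vec as Vec using (Vec; []; _∷_; lookup)
open import Data.List as List using (List; []; _∷_; [_]; concatMap; filter; length; foldr; map; allFin)
open import Data.Integer using (+_)
open import Data.Rational using (ℚ; 0ℚ; 1ℚ; _+_; _*_; _/_)
open import Relation.Binary.PropositionalEquality using (_≡_)
open import Relation.Nullary.Decidable using (Dec; _→-dec_)

ℕ→ℚ : ℕ → ℚ
ℕ→ℚ n = + n / 1

_^ᵠ_ : ℚ → ℕ → ℚ
q ^ᵠ zero = 1ℚ
q ^ᵠ suc k = q * (q ^ᵠ k)

sumℚ : List ℚ → ℚ
sumℚ = foldr _+_ 0ℚ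

words : (n k : ℕ) → List (Vec (Fin n) k)
words n zero = [ [] ]
words n (suc k) = concatMap (λ x → map (x ∷_) (words n k)) (allFin n)

-- a word of length n over Fin n (one-line notation, 0-based values) is a
-- permutation iff it is injective
IsPerm : ∀ {n} → Vec (Fin n) n → Set
IsPerm {n} σ = ∀ (i j : Fin n) → lookup σ i ≡ lookup σ j → i ≡ j

isPerm? : ∀ {n} (σ : Vec (Fin n) n) → Dec (IsPerm σ)
isPerm? σ = all? λ i → all? λ j → (lookup σ i ≟ lookup σ j) →-dec (i ≟ j)

perms : (n : ℕ) → List (Vec (Fin n) n)
perms n = filter isPerm? (words n n)

IsRecord : ∀ {n} → Vec (Fin n) n → Fin n → Set
IsRecord {n} σ i = ∀ (j : Fin n) → j Fin.< i → lookup σ j Fin.< lookup σ i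

isRecord? : ∀ {n} (σ : Vec (Fin n) n) (i : Fin n) → Dec (IsRecord σ i)
isRecord? σ i = all? λ j → (j Fin.<? i) →-dec (lookup σ j Fin.<? lookup σ i)

rec : ∀ {n} → Vec (Fin n) n → ℕ
rec {n} σ = length (filter (isRecord? σ) (allFin n))

-- σ(p) with 1-based position p and 1-based value (0 if p out of range)
at : ∀ {m k} → Vec (Fin m) k → ℕ → ℕ
at [] _ = 0
at (x ∷ xs) zero = 0
at (x ∷ xs) (suc zero) = suc (toℕ x)
at (x ∷ xs) (suc (suc p)) = at xs (suc p)

Descent : ∀ {n} → ℕ → Vec (Fin n) n → Set
Descent i σ = at σ i ℕ.< at σ (i ℕ.∸ 1)

descent? : ∀ {n} (i : ℕ) (σ : Vec (Fin n) n) → Dec (Descent i σ)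
descent? i σ = at σ i ℕ.<? at σ (i ℕ.∸ 1)

weight : ∀ {n} → ℚ → Vec (Fin n) n → ℚ
weight θ σ = θ ^ᵠ rec σ

Z : ℚ → ℕ → ℚ
Z θ n = sumℚ (map (weight θ) (perms n))

descentWeight : ℚ → (n : ℕ) → ℕ → ℚ
descentWeight θ n i = sumℚ (map (weight θ) (filter (descent? i) (perms n)))

-- "ℙ_n(σ(i-1) > σ(i)) = a / b" written as weight(event) * b = a * Z
-- (the ratio weight/Z is the probability; Z > 0 and b > 0 in our setting)
ProbDescentIs : ℚ → (n i : ℕ) → (a b : ℚ) → Set
ProbDescentIs θ n i a b = descentWeight θ n i * b ≡ a * Z θ n

module Submission where

-- Appending a value v ∈ [n+1] to τ ∈ 𝔖_n, after shifting the values ≥ v of τ up by one, is a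
-- bijection 𝔖_n × [n+1] ≅ 𝔖_{n+1}.  The new last position is a record iff v = n+1, while the
-- earlier records and all descents at positions ≤ n are those of τ.  Hence Z_{n+1} = (n+θ) Z_n,
-- and for i ≤ n the weight of σ(i-1) > σ(i) gets the same factor, so the probability is the
-- same for all n ≥ i.  For n = i the event reads v ≤ τ(i-1); since τ(i-1) < i these τ(i-1)
-- values of v all have weight 1, so the event has weight Σ_τ θ^rec(τ) τ(i-1).  Peeling off the
-- last value u of τ in the same way gives Z_{i-2} (Σ_{u=1}^{i-2} u + θ(i-1)), which equals
-- Z_{i-2} (i-1)(i-2+2θ)/2, to be compared with Z_i = Z_{i-2} (θ+i-2)(θ+i-1).

open import Defs
open import Algebra.Bundles using (CommutativeRing)
open import Data.Bool using (true; false; if_then_else_)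
open import Data.Empty using (⊥-elim)
open import Data.Fin as Fin using (Fin; toℕ; inject₁; fromℕ; fromℕ<; punchIn; punchOut)
open import Data.Fin.Properties
  using (_≟_; _≤?_; toℕ<n; toℕ-injective; toℕ-inject₁; toℕ-fromℕ; toℕ-fromℕ<; fromℕ<-injective;
         fromℕ≢inject₁; inject₁-injective; injective⇒≤;
         punchIn-injective; punchInᵢ≢i; punchIn-punchOut; punchOut-injective)
open import Data.Fin.Relation.Unary.Top using (view; ‵fromℕ; ‵inj₁)
import Data.Integer as ℤ
import Data.Integer.Properties as ℤ
open import Data.List as List
  using (List; []; _∷_; [_]; _++_; map; filter; length; allFin; tabulate; cartesianProductWith; concatMap)
open import Data.List.Properties using (map-∘; map-cong; map-tabulate; filter-++; length-++; filter-≐)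
open import Data.List.Membership.Propositional using (_∈_)
open import Data.List.Membership.Propositional.Properties
  using (∈-cartesianProductWith⁺; ∈-cartesianProductWith⁻; ∈-filter⁺; ∈-filter⁻; ∈-allFin)
open import Data.List.Membership.Propositional.Properties.WithK using (unique∧set⇒bag)
open import Data.List.Relation.Binary.BagAndSetEquality using (∼bag⇒↭)
open import Data.List.Relation.Binary.Permutation.Propositional using (_↭_; ↭⇒↭ₛ)
import Data.List.Relation.Binary.Permutation.Propositional.Properties as ↭
open import Data.List.Relation.Binary.Permutation.Setoid.Properties using (foldr-commMonoid)
import Data.List.Relation.Unary.All as All
import Data.List.Relation.Unary.AllPairs as AllPairs
open import Data.List.Relation.Unary.Any using (here; there)
open import Data.List.Relation.Unary.Unique.Propositional using (Unique)
open import Data.List.Relation.Unary.Unique.Propositional.Properties using (cartesianProductWith⁺; filter⁺; allFin⁺)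
open import Data.Nat as ℕ using (ℕ; zero; suc; z≤n; s≤s; s≤s⁻¹; s<s; s<s⁻¹; _≤_; _∸_; _≤′_; ≤′-refl; ≤′-step)
open import Data.Nat.Coprimality as Coprime using ()
import Data.Nat.Properties as ℕₚ
open import Data.Product using (_×_; _,_; proj₂; ∃₂)
open import Data.Rational using (ℚ; 0ℚ; 1ℚ; _+_; _*_; _>_; mkℚ)
open import Data.Rational.Properties
  using (normalize-coprime; /-cong; +-comm; +-assoc; +-identityˡ; +-identityʳ; *-comm; *-assoc;
         *-identityˡ; *-identityʳ; *-zeroˡ; *-zeroʳ; *-distribˡ-+; *-distribʳ-+;
         +-0-isCommutativeMonoid; +-*-commutativeRing)
open import Data.Rational.Solver using (module +-*-Solver)
open import Algebra.Properties.Semiring.Sum (CommutativeRing.semiring +-*-commutativeRing)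
  using (sum; sum-syntax; sum-cong-≗; sum-init-last; sum-replicate-zero; *-distribˡ-sum)
open import Data.Vec as Vec using (Vec; []; _∷_; _∷ʳ_; lookup; initLast)
open import Data.Vec.Properties using (lookup-map; lookup∘tabulate; ∷-injective; ∷ʳ-injective)
open import Data.Vec.Relation.Binary.Pointwise.Extensional using (ext; Pointwise-≡⇒≡)
open import Function using (_∘_; _⇔_; mk⇔; Equivalence)
import Function.Properties.Equivalence as ⇔
open import Relation.Nullary using (Dec; does; ¬_)
open import Relation.Nullary.Decidable using (dec-true; dec-false; does-⇔)
open import Relation.Unary using (Decidable)
open import Relation.Binary.PropositionalEquality
  using (_≡_; _≢_; refl; sym; trans; cong; cong₂; subst; subst₂; setoid; module ≡-Reasoning)
open ≡-Reasoning

private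
  variable
    A B C : Set
    P Q : Set

inject₁-<⇔ : ∀ {n} {i j : Fin n} → inject₁ i Fin.< inject₁ j ⇔ i Fin.< j
inject₁-<⇔ {i = i} {j} = mk⇔ (subst₂ ℕ._<_ (toℕ-inject₁ i) (toℕ-inject₁ j))
                            (subst₂ ℕ._<_ (sym (toℕ-inject₁ i)) (sym (toℕ-inject₁ j)))

inject₁-≤⇔ : ∀ {m n} (i : Fin m) (j : Fin n) → inject₁ i Fin.≤ j ⇔ i Fin.≤ j
inject₁-≤⇔ i j = mk⇔ (subst (ℕ._≤ toℕ j) (toℕ-inject₁ i)) (subst (ℕ._≤ toℕ j) (sym (toℕ-inject₁ i)))

<fromℕ : ∀ {n} (i : Fin n) → i Fin.< fromℕ n
<fromℕ {n} i = subst (toℕ i ℕ.<_) (sym (toℕ-fromℕ n)) (toℕ<n i)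

inject₁<fromℕ : ∀ {n} (i : Fin n) → inject₁ i Fin.< fromℕ n
inject₁<fromℕ i = subst (ℕ._< _) (sym (toℕ-inject₁ i)) (<fromℕ i)

punchIn-mono-< : ∀ {n} (i : Fin (suc n)) (j k : Fin n) → j Fin.< k → punchIn i j Fin.< punchIn i k
punchIn-mono-< Fin.zero    j           k           j<k       = s≤s j<k
punchIn-mono-< (Fin.suc i) Fin.zero    (Fin.suc k) _         = s≤s z≤n
punchIn-mono-< (Fin.suc i) (Fin.suc j) (Fin.suc k) (s≤s j<k) = s≤s (punchIn-mono-< i j k j<k)

punchIn-cancel-< : ∀ {n} (i : Fin (suc n)) (j k : Fin n) → punchIn i j Fin.< punchIn i k → j Fin.< k
punchIn-cancel-< Fin.zero    j           k           (s≤s j<k) = j<k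
punchIn-cancel-< (Fin.suc i) Fin.zero    (Fin.suc k) _         = s≤s z≤n
punchIn-cancel-< (Fin.suc i) (Fin.suc j) (Fin.suc k) (s≤s j<k) = s≤s (punchIn-cancel-< i j k j<k)

<punchIn⇔≤ : ∀ {n} (i : Fin (suc n)) (j : Fin n) → i Fin.< punchIn i j ⇔ i Fin.≤ j
<punchIn⇔≤ i j = mk⇔ (to i j) (from i j)
  where
  to : ∀ {n} (i : Fin (suc n)) (j : Fin n) → i Fin.< punchIn i j → i Fin.≤ j
  to Fin.zero    j           _          = z≤n
  to (Fin.suc i) (Fin.suc j) (s≤s i<j) = s≤s (to i j i<j)
  from : ∀ {n} (i : Fin (suc n)) (j : Fin n) → i Fin.≤ j → i Fin.< punchIn i j
  from Fin.zero    j           _          = s≤s z≤n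
  from (Fin.suc i) (Fin.suc j) (s≤s i≤j) = s≤s (from i j i≤j)

punchIn<⇔< : ∀ {n} (i : Fin (suc n)) (j : Fin n) → punchIn i j Fin.< i ⇔ j Fin.< i
punchIn<⇔< i j = mk⇔ (to i j) (from i j)
  where
  to : ∀ {n} (i : Fin (suc n)) (j : Fin n) → punchIn i j Fin.< i → j Fin.< i
  to (Fin.suc i) Fin.zero    _         = s≤s z≤n
  to (Fin.suc i) (Fin.suc j) (s≤s j<i) = s≤s (to i j j<i)
  from : ∀ {n} (i : Fin (suc n)) (j : Fin n) → j Fin.< i → punchIn i j Fin.< i
  from (Fin.suc i) Fin.zero    _         = s≤s z≤n
  from (Fin.suc i) (Fin.suc j) (s≤s j<i) = s≤s (from i j j<i)

ℕ→ℚ-+ : ∀ m n → ℕ→ℚ (m ℕ.+ n) ≡ ℕ→ℚ m + ℕ→ℚ n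
ℕ→ℚ-+ m n = trans (/-cong (sym (cong₂ ℤ._+_ (ℤ.*-identityʳ (ℤ.+ m)) (ℤ.*-identityʳ (ℤ.+ n)))) refl)
                  (sym (cong₂ _+_ (ℕ→ℚ≡mkℚ m) (ℕ→ℚ≡mkℚ n)))
  where
  ℕ→ℚ≡mkℚ : ∀ k → ℕ→ℚ k ≡ mkℚ (ℤ.+ k) 0 (Coprime.sym (Coprime.1-coprimeTo k))
  ℕ→ℚ≡mkℚ k = normalize-coprime (Coprime.sym (Coprime.1-coprimeTo k))

-- Entries of permutations are stored 0-based; `value` is the corresponding 1-based value.
value : ∀ {n} → Fin n → ℚ
value i = ℕ→ℚ (suc (toℕ i))

^ᵠ-+ : ∀ θ a b → θ ^ᵠ (a ℕ.+ b) ≡ θ ^ᵠ a * θ ^ᵠ b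
^ᵠ-+ θ zero    b = sym (*-identityˡ (θ ^ᵠ b))
^ᵠ-+ θ (suc a) b = trans (cong (θ *_) (^ᵠ-+ θ a b)) (sym (*-assoc θ (θ ^ᵠ a) (θ ^ᵠ b)))

𝟙 : Dec P → ℕ
𝟙 P? = if does P? then 1 else 0

𝟙-⇔ : P ⇔ Q → (P? : Dec P) (Q? : Dec Q) → 𝟙 P? ≡ 𝟙 Q?
𝟙-⇔ P⇔Q P? Q? = cong (if_then 1 else 0) (does-⇔ P⇔Q P? Q?)

isTop : ∀ {n} → Fin (suc n) → ℕ
isTop {n} v = 𝟙 (v ≟ fromℕ n)

isTop-inject₁ : ∀ {n} (i : Fin n) → isTop (inject₁ i) ≡ 0
isTop-inject₁ i = cong (if_then 1 else 0) (dec-false (inject₁ i ≟ fromℕ _) (fromℕ≢inject₁ ∘ sym))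

isTop-fromℕ : ∀ n → isTop (fromℕ n) ≡ 1
isTop-fromℕ n = cong (if_then 1 else 0) (dec-true (fromℕ n ≟ fromℕ n) refl)

infix 8 _when_

_when_ : ℚ → Dec P → ℚ
x when P? = if does P? then x else 0ℚ

when-⇔ : ∀ x → P ⇔ Q → (P? : Dec P) (Q? : Dec Q) → x when P? ≡ x when Q?
when-⇔ x P⇔Q P? Q? = cong (if_then x else 0ℚ) (does-⇔ P⇔Q P? Q?)

when-yes : ∀ x (P? : Dec P) → P → x when P? ≡ x
when-yes x P? p = cong (if_then x else 0ℚ) (dec-true P? p)

when-no : ∀ x (P? : Dec P) → ¬ P → x when P? ≡ 0ℚ
when-no x P? ¬p = cong (if_then x else 0ℚ) (dec-false P? ¬p)

*-when : ∀ x y (P? : Dec P) → (x * y) when P? ≡ x * (y when P?)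
*-when x y P? with does P?
... | true  = refl
... | false = sym (*-zeroʳ x)

when-* : ∀ x y (P? : Dec P) → (x * y) when P? ≡ (x when P?) * y
when-* x y P? with does P?
... | true  = refl
... | false = sym (*-zeroˡ y)

-- ∑ is the list sum used by Defs; sums over Fin n use the library's `sum`, written ∑[ i < n ].
∑ : List A → (A → ℚ) → ℚ
∑ xs f = sumℚ (map f xs)

infix 5 ∑
syntax ∑ xs (λ x → e) = ∑[ x ∈ xs ] e

∑-cong : {f g : A → ℚ} (xs : List A) → (∀ x → f x ≡ g x) → ∑ xs f ≡ ∑ xs g
∑-cong xs f≗g = cong sumℚ (map-cong f≗g xs)

∑-cong-∈ : {f g : A → ℚ} (xs : List A) → (∀ {x} → x ∈ xs → f x ≡ g x) → ∑ xs f ≡ ∑ xs g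
∑-cong-∈ []       f≗g = refl
∑-cong-∈ (x ∷ xs) f≗g = cong₂ _+_ (f≗g (here refl)) (∑-cong-∈ xs (f≗g ∘ there))

∑-++ : (xs ys : List A) (f : A → ℚ) → ∑ (xs ++ ys) f ≡ ∑ xs f + ∑ ys f
∑-++ []       ys f = sym (+-identityˡ _)
∑-++ (x ∷ xs) ys f = trans (cong (f x +_) (∑-++ xs ys f)) (sym (+-assoc (f x) _ _))

∑-map : (g : A → B) (xs : List A) (f : B → ℚ) → ∑ (map g xs) f ≡ ∑ xs (f ∘ g)
∑-map g xs f = cong sumℚ (sym (map-∘ xs))

∑-*ʳ : (xs : List A) (f : A → ℚ) (c : ℚ) → ∑[ x ∈ xs ] f x * c ≡ ∑ xs f * c
∑-*ʳ []       f c = sym (*-zeroˡ c)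
∑-*ʳ (x ∷ xs) f c = trans (cong (f x * c +_) (∑-*ʳ xs f c)) (sym (*-distribʳ-+ c (f x) _))

∑-↭ : {xs ys : List A} (f : A → ℚ) → xs ↭ ys → ∑ xs f ≡ ∑ ys f
∑-↭ f xs↭ys = foldr-commMonoid (setoid ℚ) +-0-isCommutativeMonoid (↭⇒↭ₛ (↭.map⁺ f xs↭ys))

∑-cartesianProductWith : (g : A → B → C) (xs : List A) (ys : List B) (f : C → ℚ) →
  ∑ (cartesianProductWith g xs ys) f ≡ ∑[ x ∈ xs ] ∑[ y ∈ ys ] f (g x y)
∑-cartesianProductWith g []       ys f = refl
∑-cartesianProductWith g (x ∷ xs) ys f = begin
  ∑ (map (g x) ys ++ cartesianProductWith g xs ys) f
    ≡⟨ ∑-++ (map (g x) ys) _ f ⟩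
  ∑ (map (g x) ys) f + ∑ (cartesianProductWith g xs ys) f
    ≡⟨ cong₂ _+_ (∑-map (g x) ys f) (∑-cartesianProductWith g xs ys f) ⟩
  (∑[ y ∈ ys ] f (g x y)) + (∑[ x ∈ xs ] ∑[ y ∈ ys ] f (g x y)) ∎

∑-filter : {R : A → Set} (R? : Decidable R) (xs : List A) (f : A → ℚ) →
  ∑ (filter R? xs) f ≡ ∑[ x ∈ xs ] f x when R? x
∑-filter R? []       f = refl
∑-filter R? (x ∷ xs) f with does (R? x)
... | true  = cong (f x +_) (∑-filter R? xs f)
... | false = trans (∑-filter R? xs f) (sym (+-identityˡ _))

∑-tabulate : ∀ {n} (g : Fin n → A) (f : A → ℚ) → ∑ (tabulate g) f ≡ sum (f ∘ g)
∑-tabulate {n = zero}  g f = refl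
∑-tabulate {n = suc n} g f = cong (f (g Fin.zero) +_) (∑-tabulate (g ∘ Fin.suc) f)

∑-allFin : ∀ {n} (f : Fin n → ℚ) → ∑ (allFin n) f ≡ sum f
∑-allFin = ∑-tabulate (λ i → i)

sum-one : ∀ n → ∑[ i < n ] 1ℚ ≡ ℕ→ℚ n
sum-one zero    = refl
sum-one (suc n) = trans (cong (1ℚ +_) (sum-one n)) (sym (ℕ→ℚ-+ 1 n))

sum-when-≤ : ∀ {n} (e : Fin n) → ∑[ i < n ] (1ℚ when (i ≤? e)) ≡ value e
sum-when-≤ {suc n} Fin.zero = begin
  ∑[ i < suc n ] (1ℚ when (i ≤? Fin.zero {n}))
    ≡⟨ cong₂ _+_ (when-yes 1ℚ (Fin.zero {n} ≤? Fin.zero {n}) z≤n)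
                 (sum-cong-≗ {n} (λ i → when-no 1ℚ (Fin.suc i ≤? Fin.zero {n}) λ ())) ⟩
  1ℚ + ∑[ i < n ] 0ℚ
    ≡⟨ cong (1ℚ +_) (sum-replicate-zero n) ⟩
  1ℚ + 0ℚ
    ≡⟨ +-identityʳ 1ℚ ⟩
  1ℚ ∎
sum-when-≤ {suc n} (Fin.suc e) = begin
  ∑[ i < suc n ] (1ℚ when (i ≤? Fin.suc e))
    ≡⟨ cong₂ _+_ (when-yes 1ℚ (Fin.zero {n} ≤? Fin.suc e) z≤n)
                 (sum-cong-≗ {n} (λ i → when-⇔ 1ℚ (mk⇔ s≤s⁻¹ s≤s) (Fin.suc i ≤? Fin.suc e) (i ≤? e))) ⟩
  1ℚ + ∑[ i < n ] (1ℚ when (i ≤? e))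
    ≡⟨ cong (1ℚ +_) (sum-when-≤ e) ⟩
  1ℚ + value e
    ≡⟨ sym (ℕ→ℚ-+ 1 (suc (toℕ e))) ⟩
  value (Fin.suc e) ∎

sum-triangular : ∀ n → ℕ→ℚ 2 * ∑[ i < n ] value i ≡ ℕ→ℚ n * ℕ→ℚ (suc n)
sum-triangular zero    = *-zeroʳ (ℕ→ℚ 2)
sum-triangular (suc n) = begin
  two * ∑[ i < suc n ] value i
    ≡⟨ cong (two *_) (sum-init-last (value {suc n})) ⟩
  two * (∑[ i < n ] value (inject₁ i) + value (fromℕ n))
    ≡⟨ cong (two *_) (cong₂ _+_ (sum-cong-≗ {n} (λ i → cong (ℕ→ℚ ∘ suc) (toℕ-inject₁ i)))
                                (cong (ℕ→ℚ ∘ suc) (toℕ-fromℕ n))) ⟩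
  two * (∑[ i < n ] value i + y)
    ≡⟨ *-distribˡ-+ two (∑[ i < n ] value i) y ⟩
  two * ∑[ i < n ] value i + two * y
    ≡⟨ cong (_+ two * y) (sum-triangular n) ⟩
  ℕ→ℚ n * y + two * y
    ≡⟨ sym (*-distribʳ-+ y (ℕ→ℚ n) two) ⟩
  (ℕ→ℚ n + two) * y
    ≡⟨ cong (_* y) (trans (+-comm (ℕ→ℚ n) two) (sym (ℕ→ℚ-+ 2 n))) ⟩
  ℕ→ℚ (2 ℕ.+ n) * y
    ≡⟨ *-comm _ y ⟩
  y * ℕ→ℚ (suc (suc n)) ∎
  where
  two = ℕ→ℚ 2
  y = ℕ→ℚ (suc n)

module _ (θ : ℚ) where

  sum-θ^isTop-init-last : ∀ n (f : Fin (suc n) → ℚ) →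
    ∑[ v < suc n ] (θ ^ᵠ isTop v * f v) ≡ ∑[ i < n ] f (inject₁ i) + θ * f (fromℕ n)
  sum-θ^isTop-init-last n f =
    trans (sum-init-last (λ v → θ ^ᵠ isTop v * f v)) (cong₂ _+_ (sum-cong-≗ {n} below) top)
    where
    below : ∀ i → θ ^ᵠ isTop (inject₁ i) * f (inject₁ i) ≡ f (inject₁ i)
    below i = trans (cong (λ k → θ ^ᵠ k * f (inject₁ i)) (isTop-inject₁ i)) (*-identityˡ _)
    top : θ ^ᵠ isTop (fromℕ n) * f (fromℕ n) ≡ θ * f (fromℕ n)
    top = trans (cong (λ k → θ ^ᵠ k * f (fromℕ n)) (isTop-fromℕ n)) (cong (_* f (fromℕ n)) (*-identityʳ θ))

  sum-θ^isTop : ∀ n → ∑[ v < suc n ] θ ^ᵠ isTop v ≡ ℕ→ℚ n + θ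
  sum-θ^isTop n = begin
    ∑[ v < suc n ] θ ^ᵠ isTop v          ≡⟨ sum-cong-≗ {suc n} (λ v → sym (*-identityʳ (θ ^ᵠ isTop v))) ⟩
    ∑[ v < suc n ] (θ ^ᵠ isTop v * 1ℚ)   ≡⟨ sum-θ^isTop-init-last n (λ _ → 1ℚ) ⟩
    ∑[ i < n ] 1ℚ + θ * 1ℚ               ≡⟨ cong₂ _+_ (sum-one n) (*-identityʳ θ) ⟩
    ℕ→ℚ n + θ                            ∎

  sum-θ^isTop-when-≤ : ∀ {k} (e : Fin (suc k)) →
    ∑[ v < suc (suc k) ] (θ ^ᵠ isTop v when (v ≤? e)) ≡ value e
  sum-θ^isTop-when-≤ {k} e = begin
    ∑[ v < suc (suc k) ] (θ ^ᵠ isTop v when (v ≤? e))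
      ≡⟨ sum-cong-≗ {suc (suc k)} (λ v → trans (cong (_when (v ≤? e)) (sym (*-identityʳ (θ ^ᵠ isTop v))))
                                               (*-when (θ ^ᵠ isTop v) 1ℚ (v ≤? e))) ⟩
    ∑[ v < suc (suc k) ] (θ ^ᵠ isTop v * 1ℚ when (v ≤? e))
      ≡⟨ sum-θ^isTop-init-last (suc k) (λ v → 1ℚ when (v ≤? e)) ⟩
    ∑[ i < suc k ] (1ℚ when (inject₁ i ≤? e)) + θ * (1ℚ when (fromℕ (suc k) ≤? e))
      ≡⟨ cong₂ _+_ (sum-cong-≗ {suc k} (λ i → when-⇔ 1ℚ (inject₁-≤⇔ i e) (inject₁ i ≤? e) (i ≤? e)))
                   (cong (θ *_) (when-no 1ℚ (fromℕ (suc k) ≤? e) (ℕₚ.<⇒≱ (<fromℕ e)))) ⟩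
    ∑[ i < suc k ] (1ℚ when (i ≤? e)) + θ * 0ℚ
      ≡⟨ cong₂ _+_ (sum-when-≤ e) (*-zeroʳ θ) ⟩
    value e + 0ℚ
      ≡⟨ +-identityʳ _ ⟩
    value e ∎

  sum-θ^isTop-*-value : ∀ m →
    ℕ→ℚ 2 * ∑[ u < suc m ] (θ ^ᵠ isTop u * value u) ≡ ℕ→ℚ (suc m) * (ℕ→ℚ 2 * θ + ℕ→ℚ m)
  sum-θ^isTop-*-value m = begin
    two * ∑[ u < suc m ] (θ ^ᵠ isTop u * value u)
      ≡⟨ cong (two *_) (sum-θ^isTop-init-last m value) ⟩
    two * (∑[ i < m ] value (inject₁ i) + θ * value (fromℕ m))
      ≡⟨ cong (two *_) (cong₂ _+_ (sum-cong-≗ {m} (λ i → cong (ℕ→ℚ ∘ suc) (toℕ-inject₁ i)))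
                                  (cong (λ k → θ * ℕ→ℚ (suc k)) (toℕ-fromℕ m))) ⟩
    two * (∑[ i < m ] value i + θ * y)
      ≡⟨ *-distribˡ-+ two (∑[ i < m ] value i) (θ * y) ⟩
    two * ∑[ i < m ] value i + two * (θ * y)
      ≡⟨ cong (_+ two * (θ * y)) (sum-triangular m) ⟩
    x * y + two * (θ * y)
      ≡⟨ solve 4 (λ two θ x y → x :* y :+ two :* (θ :* y) := y :* (two :* θ :+ x)) refl two θ x y ⟩
    y * (two * θ + x) ∎
    where
    open +-*-Solver
    two = ℕ→ℚ 2
    x = ℕ→ℚ m
    y = ℕ→ℚ (suc m)

-- Appending a last value to a permutation

lookup-∷ʳ-inject₁ : ∀ {n} (xs : Vec A n) x (i : Fin n) → lookup (xs ∷ʳ x) (inject₁ i) ≡ lookup xs i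
lookup-∷ʳ-inject₁ (y ∷ ys) x Fin.zero    = refl
lookup-∷ʳ-inject₁ (y ∷ ys) x (Fin.suc i) = lookup-∷ʳ-inject₁ ys x i

lookup-∷ʳ-fromℕ : ∀ {n} (xs : Vec A n) x → lookup (xs ∷ʳ x) (fromℕ n) ≡ x
lookup-∷ʳ-fromℕ []       x = refl
lookup-∷ʳ-fromℕ (y ∷ ys) x = lookup-∷ʳ-fromℕ ys x

extend : ∀ {n} → Vec (Fin n) n → Fin (suc n) → Vec (Fin (suc n)) (suc n)
extend τ v = Vec.map (punchIn v) τ ∷ʳ v

module _ {n} (τ : Vec (Fin n) n) (v : Fin (suc n)) where

  lookup-extend-inject₁ : ∀ i → lookup (extend τ v) (inject₁ i) ≡ punchIn v (lookup τ i)
  lookup-extend-inject₁ i = trans (lookup-∷ʳ-inject₁ (Vec.map (punchIn v) τ) v i) (lookup-map i (punchIn v) τ)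

  lookup-extend-fromℕ : lookup (extend τ v) (fromℕ n) ≡ v
  lookup-extend-fromℕ = lookup-∷ʳ-fromℕ (Vec.map (punchIn v) τ) v

  extend-<-inject₁ : ∀ i j →
    lookup (extend τ v) (inject₁ i) Fin.< lookup (extend τ v) (inject₁ j) ⇔ lookup τ i Fin.< lookup τ j
  extend-<-inject₁ i j rewrite lookup-extend-inject₁ i | lookup-extend-inject₁ j =
    mk⇔ (punchIn-cancel-< v _ _) (punchIn-mono-< v _ _)

  extend-fromℕ<inject₁⇔≤ : ∀ i →
    lookup (extend τ v) (fromℕ n) Fin.< lookup (extend τ v) (inject₁ i) ⇔ v Fin.≤ lookup τ i
  extend-fromℕ<inject₁⇔≤ i rewrite lookup-extend-inject₁ i | lookup-extend-fromℕ = <punchIn⇔≤ v (lookup τ i)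

  extend-isPerm : IsPerm τ → IsPerm (extend τ v)
  extend-isPerm τ-perm i j σi≡σj with view i | view j
  ... | ‵fromℕ          | ‵fromℕ          = refl
  ... | ‵fromℕ          | ‵inj₁ {i = j} _ = ⊥-elim (punchInᵢ≢i v (lookup τ j)
    (sym (trans (sym lookup-extend-fromℕ) (trans σi≡σj (lookup-extend-inject₁ j)))))
  ... | ‵inj₁ {i = i} _ | ‵fromℕ          = ⊥-elim (punchInᵢ≢i v (lookup τ i)
    (trans (sym (lookup-extend-inject₁ i)) (trans σi≡σj lookup-extend-fromℕ)))
  ... | ‵inj₁ {i = i} _ | ‵inj₁ {i = j} _ = cong inject₁ (τ-perm i j (punchIn-injective v _ _
    (trans (sym (lookup-extend-inject₁ i)) (trans σi≡σj (lookup-extend-inject₁ j)))))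

extend-injective : ∀ {n} {τ τ′ : Vec (Fin n) n} {v v′} → extend τ v ≡ extend τ′ v′ → τ ≡ τ′ × v ≡ v′
extend-injective {τ = τ} {τ′} {v} eq with ∷ʳ-injective (Vec.map (punchIn v) τ) _ eq
... | map≡map , refl = Pointwise-≡⇒≡ (ext λ i → punchIn-injective v _ _ (begin
  punchIn v (lookup τ i)             ≡⟨ sym (lookup-map i (punchIn v) τ) ⟩
  lookup (Vec.map (punchIn v) τ) i   ≡⟨ cong (λ xs → lookup xs i) map≡map ⟩
  lookup (Vec.map (punchIn v) τ′) i  ≡⟨ lookup-map i (punchIn v) τ′ ⟩
  punchIn v (lookup τ′ i)            ∎)) , refl

extend-surjective : ∀ {n} (σ : Vec (Fin (suc n)) (suc n)) → IsPerm σ →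
  ∃₂ λ τ v → IsPerm τ × extend τ v ≡ σ
extend-surjective {n} σ σ-perm with initLast σ
... | ys , v , refl = τ , v , τ-perm , cong (_∷ʳ v) map-punchIn-τ
  where
  v≢ys : ∀ i → v ≢ lookup ys i
  v≢ys i v≡ = fromℕ≢inject₁ (σ-perm (fromℕ n) (inject₁ i)
    (trans (lookup-∷ʳ-fromℕ ys v) (trans v≡ (sym (lookup-∷ʳ-inject₁ ys v i)))))
  τ : Vec (Fin n) n
  τ = Vec.tabulate (λ i → punchOut (v≢ys i))
  τ-perm : IsPerm τ
  τ-perm i j τi≡τj = inject₁-injective (σ-perm (inject₁ i) (inject₁ j)
    (trans (lookup-∷ʳ-inject₁ ys v i) (trans (punchOut-injective (v≢ys i) (v≢ys j)
      (trans (sym (lookup∘tabulate _ i)) (trans τi≡τj (lookup∘tabulate _ j))))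
      (sym (lookup-∷ʳ-inject₁ ys v j)))))
  map-punchIn-τ : Vec.map (punchIn v) τ ≡ ys
  map-punchIn-τ = Pointwise-≡⇒≡ (ext λ i → trans (lookup-map i (punchIn v) τ)
    (trans (cong (punchIn v) (lookup∘tabulate _ i)) (punchIn-punchOut (v≢ys i))))

-- 𝔖_(n+1) as 𝔖_n × Fin (n+1)

concatMap-map≡cartesianProductWith : (g : A → B → C) (xs : List A) (ys : List B) →
  concatMap (λ x → map (g x) ys) xs ≡ cartesianProductWith g xs ys
concatMap-map≡cartesianProductWith g []       ys = refl
concatMap-map≡cartesianProductWith g (x ∷ xs) ys =
  cong (map (g x) ys ++_) (concatMap-map≡cartesianProductWith g xs ys)

words-suc : ∀ n k → words n (suc k) ≡ cartesianProductWith _∷_ (allFin n) (words n k)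
words-suc n k = concatMap-map≡cartesianProductWith _∷_ (allFin n) (words n k)

words-unique : ∀ n k → Unique (words n k)
words-unique n zero    = All.[] AllPairs.∷ AllPairs.[]
words-unique n (suc k) rewrite words-suc n k =
  cartesianProductWith⁺ _∷_ ∷-injective (allFin⁺ n) (words-unique n k)

∈-words : ∀ n k (w : Vec (Fin n) k) → w ∈ words n k
∈-words n zero    []      = here refl
∈-words n (suc k) (x ∷ w) rewrite words-suc n k =
  ∈-cartesianProductWith⁺ _∷_ (∈-allFin x) (∈-words n k w)

perms-unique : ∀ n → Unique (perms n)
perms-unique n = filter⁺ isPerm? (words-unique n n)

∈-perms⁺ : ∀ {n} {σ : Vec (Fin n) n} → IsPerm σ → σ ∈ perms n
∈-perms⁺ {n} {σ} = ∈-filter⁺ isPerm? (∈-words n n σ)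

∈-perms⁻ : ∀ {n} {σ : Vec (Fin n) n} → σ ∈ perms n → IsPerm σ
∈-perms⁻ {n} σ∈ = proj₂ (∈-filter⁻ isPerm? {xs = words n n} σ∈)

perms-suc-↭ : ∀ n → perms (suc n) ↭ cartesianProductWith extend (perms n) (allFin (suc n))
perms-suc-↭ n = ∼bag⇒↭ (unique∧set⇒bag (perms-unique (suc n)) extensions-unique (mk⇔ to from))
  where
  extensions = cartesianProductWith extend (perms n) (allFin (suc n))
  extensions-unique : Unique extensions
  extensions-unique = cartesianProductWith⁺ extend extend-injective (perms-unique n) (allFin⁺ (suc n))
  to : ∀ {σ} → σ ∈ perms (suc n) → σ ∈ extensions
  to {σ} σ∈ with extend-surjective σ (∈-perms⁻ σ∈)
  ... | τ , v , τ-perm , refl = ∈-cartesianProductWith⁺ extend (∈-perms⁺ τ-perm) (∈-allFin v)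
  from : ∀ {σ} → σ ∈ extensions → σ ∈ perms (suc n)
  from σ∈ with ∈-cartesianProductWith⁻ extend (perms n) (allFin (suc n)) σ∈
  ... | τ , v , τ∈ , _ , refl = ∈-perms⁺ (extend-isPerm τ v (∈-perms⁻ τ∈))

∑-perms-suc : ∀ {n} (f : Vec (Fin (suc n)) (suc n) → ℚ) (g : Vec (Fin n) n → Fin (suc n) → ℚ) →
  (∀ τ v → IsPerm τ → f (extend τ v) ≡ g τ v) →
  ∑ (perms (suc n)) f ≡ ∑[ τ ∈ perms n ] sum (g τ)
∑-perms-suc {n} f g f∘extend≡g = begin
  ∑ (perms (suc n)) f
    ≡⟨ ∑-↭ f (perms-suc-↭ n) ⟩
  ∑ (cartesianProductWith extend (perms n) (allFin (suc n))) f
    ≡⟨ ∑-cartesianProductWith extend (perms n) (allFin (suc n)) f ⟩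
  ∑[ τ ∈ perms n ] ∑[ v ∈ allFin (suc n) ] f (extend τ v)
    ≡⟨ ∑-cong-∈ (perms n) (λ {τ} τ∈ → trans (∑-allFin (f ∘ extend τ))
                                             (sum-cong-≗ (λ v → f∘extend≡g τ v (∈-perms⁻ τ∈)))) ⟩
  ∑[ τ ∈ perms n ] sum (g τ) ∎

∑-perms-suc-* : ∀ {n} (f : Vec (Fin (suc n)) (suc n) → ℚ) (g : Vec (Fin n) n → ℚ) (h : Fin (suc n) → ℚ) →
  (∀ τ v → IsPerm τ → f (extend τ v) ≡ g τ * h v) →
  ∑ (perms (suc n)) f ≡ ∑ (perms n) g * sum h
∑-perms-suc-* {n} f g h f∘extend≡g*h = begin
  ∑ (perms (suc n)) f                    ≡⟨ ∑-perms-suc f (λ τ v → g τ * h v) f∘extend≡g*h ⟩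
  ∑[ τ ∈ perms n ] sum (λ v → g τ * h v) ≡⟨ ∑-cong (perms n) (λ τ → sym (*-distribˡ-sum (g τ) h)) ⟩
  ∑[ τ ∈ perms n ] g τ * sum h           ≡⟨ ∑-*ʳ (perms n) g (sum h) ⟩
  ∑ (perms n) g * sum h                  ∎

-- Records and descents

tabulate-∷ʳ : ∀ {n} (f : Fin (suc n) → A) → tabulate f ≡ tabulate (f ∘ inject₁) List.∷ʳ f (fromℕ n)
tabulate-∷ʳ {n = zero}  f = refl
tabulate-∷ʳ {n = suc n} f = cong (f Fin.zero ∷_) (tabulate-∷ʳ (f ∘ Fin.suc))

allFin-∷ʳ : ∀ n → allFin (suc n) ≡ map inject₁ (allFin n) List.∷ʳ fromℕ n
allFin-∷ʳ n = trans (tabulate-∷ʳ (λ i → i)) (cong (List._∷ʳ fromℕ n) (sym (map-tabulate (λ i → i) inject₁)))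

length-filter-[_] : {R : A → Set} (R? : Decidable R) (x : A) → length (filter R? [ x ]) ≡ 𝟙 (R? x)
length-filter-[_] R? x with does (R? x)
... | true  = refl
... | false = refl

length-filter-map : {R : B → Set} (R? : Decidable R) (f : A → B) (xs : List A) →
  length (filter R? (map f xs)) ≡ length (filter (R? ∘ f) xs)
length-filter-map R? f []       = refl
length-filter-map R? f (x ∷ xs) with does (R? (f x))
... | true  = cong suc (length-filter-map R? f xs)
... | false = length-filter-map R? f xs

length-filter-allFin-suc : ∀ {n} {R : Fin (suc n) → Set} (R? : Decidable R) →
  length (filter R? (allFin (suc n))) ≡ length (filter (R? ∘ inject₁) (allFin n)) ℕ.+ 𝟙 (R? (fromℕ n))
length-filter-allFin-suc {n} R? = begin
  length (filter R? (allFin (suc n)))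
    ≡⟨ cong (length ∘ filter R?) (allFin-∷ʳ n) ⟩
  length (filter R? (map inject₁ (allFin n) ++ [ fromℕ n ]))
    ≡⟨ cong length (filter-++ R? (map inject₁ (allFin n)) [ fromℕ n ]) ⟩
  length (filter R? (map inject₁ (allFin n)) ++ filter R? [ fromℕ n ])
    ≡⟨ length-++ (filter R? (map inject₁ (allFin n))) ⟩
  length (filter R? (map inject₁ (allFin n))) ℕ.+ length (filter R? [ fromℕ n ])
    ≡⟨ cong₂ ℕ._+_ (length-filter-map R? inject₁ (allFin n)) (length-filter-[_] R? (fromℕ n)) ⟩
  length (filter (R? ∘ inject₁) (allFin n)) ℕ.+ 𝟙 (R? (fromℕ n)) ∎

isPerm-unbounded : ∀ {n} {τ : Vec (Fin n) n} → IsPerm τ → (w : Fin n) → ¬ (∀ k → lookup τ k Fin.< w)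
isPerm-unbounded τ-perm w all<w = ℕₚ.<⇒≱ (toℕ<n w) (injective⇒≤ (λ {i} {j} τi≡τj →
  τ-perm i j (toℕ-injective (fromℕ<-injective _ _ (all<w i) (all<w j) τi≡τj))))

module _ {n} (τ : Vec (Fin n) n) (v : Fin (suc n)) where

  isRecord-extend-inject₁ : ∀ i → IsRecord (extend τ v) (inject₁ i) ⇔ IsRecord τ i
  isRecord-extend-inject₁ i = mk⇔ to from
    where
    to : IsRecord (extend τ v) (inject₁ i) → IsRecord τ i
    to record-at j j<i =
      Equivalence.to (extend-<-inject₁ τ v j i) (record-at (inject₁ j) (Equivalence.from inject₁-<⇔ j<i))
    from : IsRecord τ i → IsRecord (extend τ v) (inject₁ i)
    from record-at k k<i with view k
    ... | ‵fromℕ          = ⊥-elim (ℕₚ.<-asym k<i (inject₁<fromℕ i))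
    ... | ‵inj₁ {i = j} _ =
      Equivalence.from (extend-<-inject₁ τ v j i) (record-at j (Equivalence.to inject₁-<⇔ k<i))

  isRecord-extend-fromℕ : IsPerm τ → IsRecord (extend τ v) (fromℕ n) ⇔ v ≡ fromℕ n
  isRecord-extend-fromℕ τ-perm = mk⇔ to from
    where
    to : IsRecord (extend τ v) (fromℕ n) → v ≡ fromℕ n
    to record-at with view v
    ... | ‵fromℕ          = refl
    ... | ‵inj₁ {i = w} _ = ⊥-elim (isPerm-unbounded {τ = τ} τ-perm w λ k →
      -- a record at the end with v = inject₁ w would put every value of τ below w
      subst (toℕ (lookup τ k) ℕ.<_) (toℕ-inject₁ w) (Equivalence.to (punchIn<⇔< v (lookup τ k))
        (subst₂ Fin._<_ (lookup-extend-inject₁ τ v k) (lookup-extend-fromℕ τ v)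
          (record-at (inject₁ k) (inject₁<fromℕ k)))))
    from : v ≡ fromℕ n → IsRecord (extend τ v) (fromℕ n)
    from refl k k<n with view k
    ... | ‵fromℕ          = ⊥-elim (ℕₚ.<-irrefl refl k<n)
    ... | ‵inj₁ {i = j} _ = subst₂ Fin._<_ (sym (lookup-extend-inject₁ τ v j)) (sym (lookup-extend-fromℕ τ v))
      (Equivalence.from (punchIn<⇔< v (lookup τ j)) (<fromℕ (lookup τ j)))

  rec-extend : IsPerm τ → rec (extend τ v) ≡ rec τ ℕ.+ isTop v
  rec-extend τ-perm = begin
    rec σ
      ≡⟨ length-filter-allFin-suc (isRecord? σ) ⟩
    length (filter (isRecord? σ ∘ inject₁) (allFin n)) ℕ.+ 𝟙 (isRecord? σ (fromℕ n))
      ≡⟨ cong₂ ℕ._+_ (cong length (filter-≐ (isRecord? σ ∘ inject₁) (isRecord? τ) same-records (allFin n)))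
                     (𝟙-⇔ (isRecord-extend-fromℕ τ-perm) (isRecord? σ (fromℕ n)) (v ≟ fromℕ n)) ⟩
    rec τ ℕ.+ isTop v ∎
    where
    σ = extend τ v
    same-records = (λ {i} → Equivalence.to (isRecord-extend-inject₁ i))
                 , (λ {i} → Equivalence.from (isRecord-extend-inject₁ i))

  weight-extend : ∀ θ → IsPerm τ → weight θ (extend τ v) ≡ weight θ τ * θ ^ᵠ isTop v
  weight-extend θ τ-perm = trans (cong (θ ^ᵠ_) (rec-extend τ-perm)) (^ᵠ-+ θ (rec τ) (isTop v))

at-lookup : ∀ {m k} (xs : Vec (Fin m) k) (i : Fin k) → at xs (suc (toℕ i)) ≡ suc (toℕ (lookup xs i))
at-lookup (x ∷ xs) Fin.zero    = refl
at-lookup (x ∷ xs) (Fin.suc i) = at-lookup xs i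

descent⇔lookup< : ∀ {k m} (σ : Vec (Fin (suc k)) (suc k)) (j : Fin k) → toℕ j ≡ m →
  Descent (suc (suc m)) σ ⇔ lookup σ (Fin.suc j) Fin.< lookup σ (inject₁ j)
descent⇔lookup< σ j refl = mk⇔ (λ d → s<s⁻¹ (subst₂ ℕ._<_ at-i at-i-1 d))
                               (λ lt → subst₂ ℕ._<_ (sym at-i) (sym at-i-1) (s<s lt))
  where
  at-i = at-lookup σ (Fin.suc j)
  at-i-1 = trans (cong (λ p → at σ (suc p)) (sym (toℕ-inject₁ j))) (at-lookup σ (inject₁ j))

descent-extend : ∀ {n m} (τ : Vec (Fin n) n) v → suc (suc m) ≤ n →
  Descent (suc (suc m)) (extend τ v) ⇔ Descent (suc (suc m)) τ
descent-extend {suc k} τ v (s≤s m<k) =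
  ⇔.trans (descent⇔lookup< (extend τ v) (inject₁ j) (trans (toℕ-inject₁ j) j≡m))
          (⇔.trans (extend-<-inject₁ τ v (Fin.suc j) (inject₁ j)) (⇔.sym (descent⇔lookup< τ j j≡m)))
  where
  j = fromℕ< m<k
  j≡m = toℕ-fromℕ< m<k

descent-extend-last : ∀ {k} (τ : Vec (Fin (suc k)) (suc k)) v →
  Descent (suc (suc k)) (extend τ v) ⇔ v Fin.≤ lookup τ (fromℕ k)
descent-extend-last {k} τ v =
  ⇔.trans (descent⇔lookup< (extend τ v) (fromℕ k) (toℕ-fromℕ k)) (extend-fromℕ<inject₁⇔≤ τ v (fromℕ k))

module _ (θ : ℚ) where

  Z-suc : ∀ n → Z θ (suc n) ≡ Z θ n * (ℕ→ℚ n + θ)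
  Z-suc n = begin
    Z θ (suc n)                           ≡⟨ ∑-perms-suc-* {n} (weight θ) (weight θ) (λ v → θ ^ᵠ isTop v)
                                                           (λ τ v → weight-extend τ v θ) ⟩
    Z θ n * ∑[ v < suc n ] θ ^ᵠ isTop v  ≡⟨ cong (Z θ n *_) (sum-θ^isTop θ n) ⟩
    Z θ n * (ℕ→ℚ n + θ)                  ∎

  descentWeight-suc : ∀ {n m} → suc (suc m) ≤ n →
    descentWeight θ (suc n) (suc (suc m)) ≡ descentWeight θ n (suc (suc m)) * (ℕ→ℚ n + θ)
  descentWeight-suc {n} {m} i≤n = begin
    descentWeight θ (suc n) i
      ≡⟨ ∑-filter (descent? i) (perms (suc n)) (weight θ) ⟩
    ∑[ σ ∈ perms (suc n) ] weight θ σ when descent? i σ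
      ≡⟨ ∑-perms-suc-* _ (λ τ → weight θ τ when descent? i τ) (λ v → θ ^ᵠ isTop v) extend-step ⟩
    (∑[ τ ∈ perms n ] weight θ τ when descent? i τ) * ∑[ v < suc n ] θ ^ᵠ isTop v
      ≡⟨ cong₂ _*_ (sym (∑-filter (descent? i) (perms n) (weight θ))) (sum-θ^isTop θ n) ⟩
    descentWeight θ n i * (ℕ→ℚ n + θ) ∎
    where
    i = suc (suc m)
    extend-step : ∀ τ v → IsPerm τ →
      weight θ (extend τ v) when descent? i (extend τ v) ≡ (weight θ τ when descent? i τ) * θ ^ᵠ isTop v
    extend-step τ v τ-perm = begin
      weight θ (extend τ v) when descent? i (extend τ v)
        ≡⟨ when-⇔ _ (descent-extend τ v i≤n) (descent? i (extend τ v)) (descent? i τ) ⟩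
      weight θ (extend τ v) when descent? i τ
        ≡⟨ cong (_when descent? i τ) (weight-extend τ v θ τ-perm) ⟩
      (weight θ τ * θ ^ᵠ isTop v) when descent? i τ
        ≡⟨ when-* (weight θ τ) (θ ^ᵠ isTop v) (descent? i τ) ⟩
      (weight θ τ when descent? i τ) * θ ^ᵠ isTop v ∎

  descentWeight-last : ∀ m →
    descentWeight θ (suc (suc m)) (suc (suc m)) ≡ Z θ m * ∑[ u < suc m ] (θ ^ᵠ isTop u * value u)
  descentWeight-last m = begin
    descentWeight θ (suc (suc m)) i
      ≡⟨ ∑-filter (descent? i) (perms (suc (suc m))) (weight θ) ⟩
    ∑[ σ ∈ perms (suc (suc m)) ] weight θ σ when descent? i σ
      ≡⟨ ∑-perms-suc _ (λ τ v → weight θ τ * factor τ v) extend-step₁ ⟩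
    ∑[ τ ∈ perms (suc m) ] ∑[ v < suc (suc m) ] (weight θ τ * factor τ v)
      ≡⟨ ∑-cong (perms (suc m)) (λ τ → sym (*-distribˡ-sum (weight θ τ) (factor τ))) ⟩
    ∑[ τ ∈ perms (suc m) ] weight θ τ * ∑[ v < suc (suc m) ] factor τ v
      ≡⟨ ∑-cong (perms (suc m)) (λ τ → cong (weight θ τ *_) (sum-θ^isTop-when-≤ θ (last τ))) ⟩
    ∑[ τ ∈ perms (suc m) ] weight θ τ * value (last τ)
      ≡⟨ ∑-perms-suc-* _ (weight θ) (λ u → θ ^ᵠ isTop u * value u) extend-step₂ ⟩
    Z θ m * ∑[ u < suc m ] (θ ^ᵠ isTop u * value u) ∎
    where
    i = suc (suc m)
    last : Vec (Fin (suc m)) (suc m) → Fin (suc m)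
    last τ = lookup τ (fromℕ m)
    factor : Vec (Fin (suc m)) (suc m) → Fin (suc (suc m)) → ℚ
    factor τ v = θ ^ᵠ isTop v when (v ≤? last τ)
    extend-step₁ : ∀ τ v → IsPerm τ →
      weight θ (extend τ v) when descent? i (extend τ v) ≡ weight θ τ * factor τ v
    extend-step₁ τ v τ-perm = begin
      weight θ (extend τ v) when descent? i (extend τ v)
        ≡⟨ when-⇔ _ (descent-extend-last τ v) (descent? i (extend τ v)) (v ≤? last τ) ⟩
      weight θ (extend τ v) when (v ≤? last τ)
        ≡⟨ cong (_when (v ≤? last τ)) (weight-extend τ v θ τ-perm) ⟩
      (weight θ τ * θ ^ᵠ isTop v) when (v ≤? last τ)
        ≡⟨ *-when (weight θ τ) (θ ^ᵠ isTop v) (v ≤? last τ) ⟩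
      weight θ τ * factor τ v ∎
    extend-step₂ : ∀ ρ u → IsPerm ρ →
      weight θ (extend ρ u) * value (last (extend ρ u)) ≡ weight θ ρ * (θ ^ᵠ isTop u * value u)
    extend-step₂ ρ u ρ-perm = begin
      weight θ (extend ρ u) * value (last (extend ρ u))
        ≡⟨ cong₂ (λ w l → w * value l) (weight-extend ρ u θ ρ-perm) (lookup-extend-fromℕ ρ u) ⟩
      weight θ ρ * θ ^ᵠ isTop u * value u
        ≡⟨ *-assoc (weight θ ρ) _ _ ⟩
      weight θ ρ * (θ ^ᵠ isTop u * value u) ∎

scale-proportion : ∀ {d z a b c d′ z′ : ℚ} → d′ ≡ d * c → z′ ≡ z * c → d * b ≡ a * z → d′ * b ≡ a * z′
scale-proportion {d} {z} {a} {b} {c} {d′} {z′} d′≡dc z′≡zc db≡az = begin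
  d′ * b       ≡⟨ cong (_* b) d′≡dc ⟩
  d * c * b    ≡⟨ *-assoc d c b ⟩
  d * (c * b)  ≡⟨ cong (d *_) (*-comm c b) ⟩
  d * (b * c)  ≡⟨ sym (*-assoc d b c) ⟩
  d * b * c    ≡⟨ cong (_* c) db≡az ⟩
  a * z * c    ≡⟨ *-assoc a z c ⟩
  a * (z * c)  ≡⟨ cong (a *_) (sym z′≡zc) ⟩
  a * z′       ∎

probDescentIs-last : ∀ θ m → ProbDescentIs θ (suc (suc m)) (suc (suc m))
  (ℕ→ℚ (suc m) * (ℕ→ℚ 2 * θ + ℕ→ℚ m)) (ℕ→ℚ 2 * (θ + ℕ→ℚ (suc m)) * (θ + ℕ→ℚ m))
probDescentIs-last θ m = begin
  descentWeight θ (suc (suc m)) (suc (suc m)) * (two * (θ + y) * (θ + x))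
    ≡⟨ cong (_* (two * (θ + y) * (θ + x))) (descentWeight-last θ m) ⟩
  Z θ m * s * (two * (θ + y) * (θ + x))
    ≡⟨ solve 6 (λ z s two θ x y → z :* s :* (two :* (θ :+ y) :* (θ :+ x))
                                := (two :* s) :* (z :* (x :+ θ) :* (y :+ θ))) refl (Z θ m) s two θ x y ⟩
  (two * s) * (Z θ m * (x + θ) * (y + θ))
    ≡⟨ cong₂ _*_ (sum-θ^isTop-*-value θ m) (sym (trans (Z-suc θ (suc m)) (cong (_* (y + θ)) (Z-suc θ m)))) ⟩
  y * (two * θ + x) * Z θ (suc (suc m)) ∎
  where
  open +-*-Solver
  s = ∑[ u < suc m ] (θ ^ᵠ isTop u * value u)
  two = ℕ→ℚ 2
  x = ℕ→ℚ m
  y = ℕ→ℚ (suc m)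

-- The identity is cross-multiplied, so it holds for every θ.
theorem2 : (θ : ℚ) → θ > 0ℚ → (n : ℕ) → 2 ≤ n → (i : ℕ) → 2 ≤ i → i ≤ n →
    ProbDescentIs θ n i
      (ℕ→ℚ (i ∸ 1) * (ℕ→ℚ 2 * θ + ℕ→ℚ (i ∸ 2)))
      (ℕ→ℚ 2 * (θ + ℕ→ℚ (i ∸ 1)) * (θ + ℕ→ℚ (i ∸ 2)))
theorem2 θ _ _ _ 1 (s≤s ()) _
theorem2 θ _ _ _ (suc (suc m)) _ i≤n = from-last (ℕₚ.≤⇒≤′ i≤n)
  where
  a = ℕ→ℚ (suc m) * (ℕ→ℚ 2 * θ + ℕ→ℚ m)
  b = ℕ→ℚ 2 * (θ + ℕ→ℚ (suc m)) * (θ + ℕ→ℚ m)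
  from-last : ∀ {n} → suc (suc m) ≤′ n → ProbDescentIs θ n (suc (suc m)) a b
  from-last ≤′-refl           = probDescentIs-last θ m
  from-last (≤′-step {n} i≤n) = scale-proportion {d = descentWeight θ n (suc (suc m))} {a = a} {b = b}
    (descentWeight-suc θ (ℕₚ.≤′⇒≤ i≤n)) (Z-suc θ n) (from-last i≤n)
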